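{- Let $n\ge 4$ and let $\operatorname{SD}_{2^n}=\langle a,b\mid a^{2^{n-1}}=b^2=1,\ bab=a^{2^{n-2}-1}\rangle$ be the semidihedral group of order $2^n$. Then \[ c(\operatorname{SD}_{2^n})\ge\left\lfloor\frac{5(n-1)}{2}\right\rfloor=\begin{cases}5m-3 & n=2m,\\ 5m & n=2m+1.\end{cases}\]
   Context: For a finite group $G$, a $G$-transfer system is a partial order $\to$ on the set $\operatorname{Sub}(G)$ of subgroups of $G$ such that: (i) $K\to H$ implies $K\le H$; (ii) $H\to H$ for all $H$; (iii) $L\to K$ and $K\to H$ imply $L\to H$; (iv) $K\to H$ and $L\le H$ imply $K\cap L\to H\cap L$; (v) $K\to H$ implies $gKg^{ -1}\to gHg^{ -1}$ for all $g\in G$. Let $\operatorname{Tr}(G)$ be the set of $G$-transfer systems. For a set $S$ of pairs $(K,H)$ with $K\le H$, $\langle S\rangle$ denotes the smallest transfer system containing $S$. A minimal generating set of $T\in\operatorname{Tr}(G)$ is a set $S$ with $\langle S\rangle=T$ such that no $a\in S$ lies in $\langle S\setminus\{a\}\rangle$. All minimal generating sets of a given $T$ have the same size $m(T)$, and the complexity is $c(G)=\max\{m(T)\mid T\in\operatorname{Tr}(G)\}$. -}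

module Defs where

open import Data.Nat using (ℕ; zero; suc; _+_; _*_; _∸_; _^_; _≤_; NonZero)
open import Data.Nat.Properties using (m^n≢0)
open import Data.Nat.DivMod using (_%_; m%n<n)
open import Data.Fin using (Fin; toℕ; fromℕ<)
open import Data.Bool using (Bool; true; false; _xor_; _∧_)
open import Data.Vec using (Vec; lookup; tabulate; zipWith)
open import Data.Product using (_×_; _,_; proj₁; proj₂)
open import Data.List using (List)
open import Data.List.Membership.Propositional using (_∈_)
open import Relation.Binary.PropositionalEquality using (_≡_; _≢_)
open import Relation.Nullary using (¬_)

-- An element (i , s) stands for a^i b^s, with i taken modulo 2^(n-1)
-- and s ∈ {0,1} (false = 0, true = 1).  The relation b a b = a^r with
-- r = 2^(n-2) - 1 gives  b^s a^k = a^(k r^s) b^s, hence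
--   (a^i b^s)(a^k b^t) = a^(i + k r^s) b^(s+t).

N : ℕ → ℕ
N n = 2 ^ (n ∸ 1)

N-nonZero : ∀ n → NonZero (N n)
N-nonZero n = m^n≢0 2 (n ∸ 1)

-- exponent r with b a b = a^r
r : ℕ → ℕ
r n = 2 ^ (n ∸ 2) ∸ 1

red : (n : ℕ) → ℕ → Fin (N n)
red n m = fromℕ< (m%n<n m (N n) {{N-nonZero n}})

SD : ℕ → Set
SD n = Fin (N n) × Bool

-- a^k conjugated through b^s : exponent k r^s
twist : (n : ℕ) → Bool → ℕ → ℕ
twist n false k = k
twist n true  k = k * r n

mul : (n : ℕ) → SD n → SD n → SD n
mul n (i , s) (k , t) = red n (toℕ i + twist n s (toℕ k)) , s xor t

e : (n : ℕ) → SD n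
e n = red n 0 , false

-- inverses: (a^i)^(-1) = a^(-i),  (a^i b)^(-1) = b a^(-i) = a^(-i r) b
inv : (n : ℕ) → SD n → SD n
inv n (i , false) = red n (N n ∸ toℕ i) , false
inv n (i , true)  = red n ((N n ∸ toℕ i) * r n) , true

-- Subsets of SD_{2^n}: a pair of bit-vectors (A , B) where
-- a^i ∈ (A , B) iff A[i] = true and a^i b ∈ (A , B) iff B[i] = true.
-- This representation is canonical, so ≡ is equality of subsets.

SubSet : ℕ → Set
SubSet n = Vec Bool (N n) × Vec Bool (N n)

memb : (n : ℕ) → SD n → SubSet n → Bool
memb n (i , false) (A , B) = lookup A i
memb n (i , true)  (A , B) = lookup B i

InG : (n : ℕ) → SD n → SubSet n → Set
InG n x H = memb n x H ≡ true

Incl : (n : ℕ) → SubSet n → SubSet n → Set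
Incl n K H = ∀ (x : SD n) → InG n x K → InG n x H

Inter : (n : ℕ) → SubSet n → SubSet n → SubSet n
Inter n (A , B) (A' , B') = zipWith _∧_ A A' , zipWith _∧_ B B'

-- conjugate  g K g⁻¹ = { x | g⁻¹ x g ∈ K }
conjG : (n : ℕ) → SD n → SubSet n → SubSet n
conjG n g K =
  tabulate (λ i → memb n (mul n (mul n (inv n g) (i , false)) g) K) ,
  tabulate (λ i → memb n (mul n (mul n (inv n g) (i , true)) g) K)

record IsSubgroup (n : ℕ) (H : SubSet n) : Set where
  field
    has-e   : InG n (e n) H
    has-mul : ∀ x y → InG n x H → InG n y H → InG n (mul n x y) H
    has-inv : ∀ x → InG n x H → InG n (inv n x) H

-- Transfer systems on Sub(SD_{2^n}), as relations  K → H  written T K H.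

Rel : ℕ → Set₁
Rel n = SubSet n → SubSet n → Set

record IsTransferSystem (n : ℕ) (T : Rel n) : Set where
  field
    dom       : ∀ {K H} → T K H → IsSubgroup n K × IsSubgroup n H
    sub       : ∀ {K H} → T K H → Incl n K H
    reflT     : ∀ H → IsSubgroup n H → T H H
    antisym   : ∀ {K H} → T K H → T H K → K ≡ H
    transT    : ∀ {L K H} → T L K → T K H → T L H
    restrict  : ∀ {K H L} → T K H → IsSubgroup n L → Incl n L H →
                T (Inter n K L) (Inter n H L)
    conjugate : ∀ {K H} → T K H → ∀ g → T (conjG n g K) (conjG n g H)

data Gen (n : ℕ) (P : SubSet n × SubSet n → Set) : Rel n where
  base  : ∀ {K H} → P (K , H) → Gen n P K H
  refl  : ∀ H → IsSubgroup n H → Gen n P H H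
  trans : ∀ {L K H} → Gen n P L K → Gen n P K H → Gen n P L H
  restr : ∀ {K H L} → Gen n P K H → IsSubgroup n L → Incl n L H →
          Gen n P (Inter n K L) (Inter n H L)
  conj  : ∀ {K H} → Gen n P K H → ∀ g → Gen n P (conjG n g K) (conjG n g H)

Pair : ℕ → Set
Pair n = SubSet n × SubSet n

record IsMinGenSet (n : ℕ) (T : Rel n) (S : List (Pair n)) : Set where
  field
    generates : ∀ K H → (T K H → Gen n (_∈ S) K H) × (Gen n (_∈ S) K H → T K H)
    minimal   : ∀ {a} → a ∈ S →
                ¬ Gen n (λ x → x ∈ S × x ≢ a) (proj₁ a) (proj₂ a)

module Submission where

open import Algebra.Bundles using (Group)
open import Algebra.Structures using (IsGroup)
open import Data.Bool using (Bool; true; false; _xor_; _∧_)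
open import Data.Bool.Properties using (xor-assoc; xor-identityʳ)
open import Data.Empty using (⊥; ⊥-elim)
open import Data.Fin using (Fin; toℕ)
open import Data.Fin.Properties using (toℕ-injective; toℕ-fromℕ<; toℕ<n)
open import Data.List using (List; []; _∷_; map; _++_; upTo; applyUpTo; length)
open import Data.List.Membership.Propositional using (_∈_)
open import Data.List.Membership.Propositional.Properties using (∈-map⁻)
open import Data.List.Properties using (map-++; map-applyUpTo; length-map; length-upTo)
open import Data.List.Relation.Unary.All as All using (All; []; _∷_)
open import Data.List.Relation.Unary.All.Properties using (Any¬⇒¬All; map⁺; map⁻; ++⁺; applyUpTo⁺₁)
open import Data.List.Relation.Unary.AllPairs using ([]; _∷_)
open import Data.List.Relation.Unary.Any using (Any; here; there)
open import Data.List.Relation.Unary.Unique.Propositional using (Unique)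
import Data.List.Relation.Unary.Unique.Propositional.Properties as Unique
open import Data.Nat using (ℕ; zero; suc; _+_; _*_; _∸_; _^_; _≤_; _<_; z≤n; s≤s; z<s; NonZero; ≢-nonZero⁻¹; _≟_; _≤?_; _<?_; ⌊_/2⌋)
open import Data.Nat.DivMod
open import Data.Nat.Divisibility using (_∣_; divides)
open import Data.Nat.Properties
open import Data.Nat.Tactic.RingSolver using (solve-∀)
open import Data.Product using (_×_; _,_; proj₁; proj₂; Σ; ∃; uncurry)
open import Data.Unit using (⊤; tt)
open import Data.Vec using (Vec; lookup; tabulate)
open import Data.Vec.Properties using (lookup∘tabulate; lookup-zipWith; tabulate∘lookup; tabulate-cong)
open import Function using (_∘_; id)
open import Relation.Binary.Bundles using (Setoid)
open import Relation.Binary.Definitions using (tri<; tri≈; tri>)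
open import Relation.Binary.PropositionalEquality
  using (_≡_; _≢_; refl; sym; trans; cong; cong₂; subst; isEquivalence; module ≡-Reasoning)
import Relation.Binary.Reasoning.Setoid
open import Relation.Nullary using (¬_; Dec; yes; no; does; map′; contradiction)
open import Relation.Nullary.Decidable using (dec-true)

open import Defs hiding (refl; trans)

-- Write L = n − 1 (so a has order 2^L), m = ⌊n/2⌋, and C j = ⟨a^(2^j)⟩, D j = ⟨a^(2^j), b⟩,
-- Q j = ⟨a^(2^j), ab⟩.  The ⌊5(n−1)/2⌋ pairs
--   C (m+i) → D (m−i),  C (m+i) → Q (m−i),  C (m+i) → C (m−i−1)   (i < m),
--   D (j+1) → D j  (m ≤ j < L),  Q (j+1) → Q j  (m ≤ j < L − 1),  and 1 → G for odd n
-- minimally generate the transfer system they generate.  For minimality, each pair K → H gets a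
-- trigger d ∈ K and tests E ⊆ H not all in K.  The property "if K′ contains a conjugate of d, then
-- every conjugate E^h ⊆ H′ already lies in K′" is closed under the operations that generate a
-- transfer system, holds for every other pair of the family, and fails for K → H itself.  Whether
-- a conjugate of a^(2^l), b or ab lies in C j, D j or Q j is read off from exponents modulo 2^j:
-- conjugation multiplies the exponent of a rotation by 1 or by the odd number r, and preserves the
-- parity of the exponent of a reflection.

-- Instance search does not find NonZero (2 ^ j) for a variable j, so it is supplied explicitly.
infixl 7 _%2^_
_%2^_ : ℕ → ℕ → ℕ
x %2^ j = _%_ x (2 ^ j) {{m^n≢0 2 j}}

infix 4 _≡_mod2^_
record _≡_mod2^_ (x y j : ℕ) : Set where
  constructor congruent
  field %2^-≡ : x %2^ j ≡ y %2^ j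
open _≡_mod2^_ public

mod-refl : ∀ {j x} → x ≡ x mod2^ j
mod-refl = congruent refl

mod-sym : ∀ {j x y} → x ≡ y mod2^ j → y ≡ x mod2^ j
mod-sym (congruent p) = congruent (sym p)

mod-trans : ∀ {j x y z} → x ≡ y mod2^ j → y ≡ z mod2^ j → x ≡ z mod2^ j
mod-trans (congruent p) (congruent q) = congruent (trans p q)

mod-setoid : ℕ → Setoid _ _
mod-setoid j = record
  { Carrier       = ℕ
  ; _≈_           = λ x y → x ≡ y mod2^ j
  ; isEquivalence = record { refl = mod-refl ; sym = mod-sym ; trans = mod-trans }
  }

module ModReasoning (j : ℕ) = Relation.Binary.Reasoning.Setoid (mod-setoid j)

2^i∣2^j : ∀ {i j} → i ≤ j → 2 ^ i ∣ 2 ^ j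
2^i∣2^j {i} {j} i≤j = divides (2 ^ (j ∸ i)) (begin
  2 ^ j                 ≡⟨ cong (2 ^_) (m+[n∸m]≡n i≤j) ⟨
  2 ^ (i + (j ∸ i))     ≡⟨ ^-distribˡ-+-* 2 i (j ∸ i) ⟩
  2 ^ i * 2 ^ (j ∸ i)   ≡⟨ *-comm (2 ^ i) _ ⟩
  2 ^ (j ∸ i) * 2 ^ i   ∎)
  where open ≡-Reasoning

module _ {j : ℕ} where
  private instance
    2^j≢0 : NonZero (2 ^ j)
    2^j≢0 = m^n≢0 2 j

  ≡⇒mod : ∀ {x y} → x ≡ y → x ≡ y mod2^ j
  ≡⇒mod refl = congruent refl

  %2^-mod : ∀ x → x %2^ j ≡ x mod2^ j
  %2^-mod x = congruent (m%n%n≡m%n x (2 ^ j))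

  mod-+ : ∀ {x x′ y y′} → x ≡ x′ mod2^ j → y ≡ y′ mod2^ j → x + y ≡ x′ + y′ mod2^ j
  mod-+ {x} {x′} {y} {y′} (congruent p) (congruent q) = congruent (begin
    (x + y) % 2 ^ j                  ≡⟨ %-distribˡ-+ x y (2 ^ j) ⟩
    (x % 2 ^ j + y % 2 ^ j) % 2 ^ j   ≡⟨ cong₂ (λ u v → (u + v) % 2 ^ j) p q ⟩
    (x′ % 2 ^ j + y′ % 2 ^ j) % 2 ^ j ≡⟨ %-distribˡ-+ x′ y′ (2 ^ j) ⟨
    (x′ + y′) % 2 ^ j                ∎)
    where open ≡-Reasoning

  mod-* : ∀ {x x′ y y′} → x ≡ x′ mod2^ j → y ≡ y′ mod2^ j → x * y ≡ x′ * y′ mod2^ j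
  mod-* {x} {x′} {y} {y′} (congruent p) (congruent q) = congruent (begin
    (x * y) % 2 ^ j                    ≡⟨ %-distribˡ-* x y (2 ^ j) ⟩
    (x % 2 ^ j * (y % 2 ^ j)) % 2 ^ j   ≡⟨ cong₂ (λ u v → (u * v) % 2 ^ j) p q ⟩
    (x′ % 2 ^ j * (y′ % 2 ^ j)) % 2 ^ j ≡⟨ %-distribˡ-* x′ y′ (2 ^ j) ⟨
    (x′ * y′) % 2 ^ j                  ∎)
    where open ≡-Reasoning

  mod-+ˡ : ∀ x {y y′} → y ≡ y′ mod2^ j → x + y ≡ x + y′ mod2^ j
  mod-+ˡ x = mod-+ (mod-refl {x = x})

  mod-*ˡ : ∀ x {y y′} → y ≡ y′ mod2^ j → x * y ≡ x * y′ mod2^ j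
  mod-*ˡ x = mod-* (mod-refl {x = x})

  *2^-mod : ∀ c → c * 2 ^ j ≡ 0 mod2^ j
  *2^-mod c = congruent (trans (m*n%n≡0 c (2 ^ j)) (sym (m<n⇒m%n≡m (m^n>0 2 j))))

  mod-cancelʳ-+ : ∀ {x y} z → x + z ≡ y + z mod2^ j → x ≡ y mod2^ j
  mod-cancelʳ-+ {x} {y} z p = begin
    x                             ≈⟨ absorb x ⟨
    x + z + z * (2 ^ j ∸ 1)       ≈⟨ mod-+ p mod-refl ⟩
    y + z + z * (2 ^ j ∸ 1)       ≈⟨ absorb y ⟩
    y                             ∎
    where
    open ModReasoning j
    z+z[d∸1]≡zd : z + z * (2 ^ j ∸ 1) ≡ z * 2 ^ j
    z+z[d∸1]≡zd = trans (sym (*-suc z _)) (cong (z *_) (suc-pred (2 ^ j)))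
    absorb : ∀ w → w + z + z * (2 ^ j ∸ 1) ≡ w mod2^ j
    absorb w = begin
      w + z + z * (2 ^ j ∸ 1)   ≡⟨ trans (+-assoc w z _) (cong (w +_) z+z[d∸1]≡zd) ⟩
      w + z * 2 ^ j             ≈⟨ mod-+ˡ w (*2^-mod z) ⟩
      w + 0                     ≡⟨ +-identityʳ w ⟩
      w                         ∎

mod-weaken : ∀ {i j x y} → i ≤ j → x ≡ y mod2^ j → x ≡ y mod2^ i
mod-weaken {i} {j} {x} {y} i≤j (congruent p) = congruent (begin
  x %2^ i         ≡⟨ reduce x ⟨
  x %2^ j %2^ i   ≡⟨ cong (_%2^ i) p ⟩
  y %2^ j %2^ i   ≡⟨ reduce y ⟩
  y %2^ i         ∎)
  where
  open ≡-Reasoning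
  reduce : ∀ z → z %2^ j %2^ i ≡ z %2^ i
  reduce z = m∣n⇒o%n%m≡o%m (2 ^ i) (2 ^ j) z {{m^n≢0 2 i}} {{m^n≢0 2 j}} (2^i∣2^j i≤j)

2^l≡0 : ∀ {j l} → j ≤ l → 2 ^ l ≡ 0 mod2^ j
2^l≡0 j≤l with 2^i∣2^j j≤l
... | divides c 2^l≡c2^j = mod-trans (≡⇒mod 2^l≡c2^j) (*2^-mod c)

2^l≡0⇒j≤l : ∀ {j l} → 2 ^ l ≡ 0 mod2^ j → j ≤ l
2^l≡0⇒j≤l {j} {l} (congruent p) with j ≤? l
... | yes j≤l = j≤l
... | no j≰l = contradiction (begin
  2 ^ l         ≡⟨ m<n⇒m%n≡m {{m^n≢0 2 j}} (^-monoʳ-< 2 (s≤s (s≤s z≤n)) (≰⇒> j≰l)) ⟨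
  2 ^ l %2^ j   ≡⟨ p ⟩
  0 %2^ j       ≡⟨ m<n⇒m%n≡m {{m^n≢0 2 j}} (m^n>0 2 j) ⟩
  0             ∎) (≢-nonZero⁻¹ (2 ^ l) {{m^n≢0 2 l}})
  where open ≡-Reasoning

infix 4 _≟_mod2^_
_≟_mod2^_ : ∀ x y j → Dec (x ≡ y mod2^ j)
x ≟ y mod2^ j = map′ congruent %2^-≡ (x %2^ j ≟ y %2^ j)

1≢0[mod2] : ¬ (1 ≡ 0 mod2^ 1)
1≢0[mod2] (congruent ())

∧-true⁻ : ∀ {a b} → a ∧ b ≡ true → a ≡ true × b ≡ true
∧-true⁻ {true} {true} refl = refl , refl

∧-true⁺ : ∀ {a b} → a ≡ true → b ≡ true → a ∧ b ≡ true
∧-true⁺ refl refl = refl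

true⇔true⇒≡ : ∀ {a b : Bool} → (a ≡ true → b ≡ true) → (b ≡ true → a ≡ true) → a ≡ b
true⇔true⇒≡ {false} {false} _ _ = refl
true⇔true⇒≡ {false} {true}  _ g = g refl
true⇔true⇒≡ {true}  {false} f _ = sym (f refl)
true⇔true⇒≡ {true}  {true}  _ _ = refl

lookup-ext : ∀ {m} {A : Set} (u v : Vec A m) → (∀ i → lookup u i ≡ lookup v i) → u ≡ v
lookup-ext u v p = trans (sym (tabulate∘lookup u)) (trans (tabulate-cong p) (tabulate∘lookup v))

does-sound : ∀ {P : Set} (P? : Dec P) → does P? ≡ true → P
does-sound (yes p) _ = p

applyUpTo-+ : ∀ {A : Set} (f : ℕ → A) p q → applyUpTo f (p + q) ≡ applyUpTo f p ++ applyUpTo (f ∘ (p +_)) q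
applyUpTo-+ f zero    q = refl
applyUpTo-+ f (suc p) q = cong (f 0 ∷_) (applyUpTo-+ (f ∘ suc) p q)

map-++≡applyUpTo-+ : ∀ {A B : Set} (h : A → B) (g : ℕ → B) p {q} (xs ys : List A) →
  map h xs ≡ applyUpTo g p → map h ys ≡ applyUpTo (g ∘ (p +_)) q → map h (xs ++ ys) ≡ applyUpTo g (p + q)
map-++≡applyUpTo-+ h g p {q} xs ys xs-image ys-image = begin
  map h (xs ++ ys)                           ≡⟨ map-++ h xs ys ⟩
  map h xs ++ map h ys                       ≡⟨ cong₂ _++_ xs-image ys-image ⟩
  applyUpTo g p ++ applyUpTo (g ∘ (p +_)) q  ≡⟨ applyUpTo-+ g p q ⟨
  applyUpTo g (p + q)                        ∎
  where open ≡-Reasoning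

Unique-map⁺ : ∀ {A B : Set} {P : A → Set} {f : A → B} {xs} →
  (∀ {x y} → P x → P y → x ≢ y → f x ≢ f y) → All P xs → Unique xs → Unique (map f xs)
Unique-map⁺ f-sep []         []           = []
Unique-map⁺ f-sep (px ∷ pxs) (x∉xs ∷ xs!) =
  map⁺ (All.zipWith (λ (x≢y , py) → f-sep px py x≢y) (x∉xs , pxs)) ∷ Unique-map⁺ f-sep pxs xs!

⌊x+x+y/2⌋≡x+⌊y/2⌋ : ∀ x y → ⌊ x + x + y /2⌋ ≡ x + ⌊ y /2⌋
⌊x+x+y/2⌋≡x+⌊y/2⌋ zero    y = refl
⌊x+x+y/2⌋≡x+⌊y/2⌋ (suc x) y =
  trans (cong (λ z → ⌊ suc z + y /2⌋) (+-suc x x)) (cong suc (⌊x+x+y/2⌋≡x+⌊y/2⌋ x y))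

module Conjugation {c ℓ} (𝒢 : Group c ℓ) where
  open Group 𝒢 hiding (refl; sym; trans; setoid)
  open import Algebra.Properties.Group 𝒢 using (\\-leftDividesˡ; inverseʳ-unique; ⁻¹-anti-homo-∙; ε⁻¹≈ε)
  open import Relation.Binary.Reasoning.Setoid (Group.setoid 𝒢)

  infixl 8 _^ᶜ_
  _^ᶜ_ : Carrier → Carrier → Carrier
  x ^ᶜ g = g ⁻¹ ∙ x ∙ g

  ε-^ᶜ : ∀ g → ε ^ᶜ g ≈ ε
  ε-^ᶜ g = begin
    g ⁻¹ ∙ ε ∙ g   ≈⟨ ∙-congʳ (identityʳ (g ⁻¹)) ⟩
    g ⁻¹ ∙ g       ≈⟨ inverseˡ g ⟩
    ε              ∎

  ^ᶜ-ε : ∀ x → x ^ᶜ ε ≈ x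
  ^ᶜ-ε x = begin
    ε ⁻¹ ∙ x ∙ ε   ≈⟨ identityʳ _ ⟩
    ε ⁻¹ ∙ x       ≈⟨ ∙-congʳ ε⁻¹≈ε ⟩
    ε ∙ x          ≈⟨ identityˡ x ⟩
    x              ∎

  ∙-^ᶜ : ∀ x y g → (x ∙ y) ^ᶜ g ≈ x ^ᶜ g ∙ y ^ᶜ g
  ∙-^ᶜ x y g = begin
    g ⁻¹ ∙ (x ∙ y) ∙ g                 ≈⟨ ∙-congʳ (assoc (g ⁻¹) x y) ⟨
    g ⁻¹ ∙ x ∙ y ∙ g                   ≈⟨ ∙-congʳ (∙-congˡ (\\-leftDividesˡ g y)) ⟨
    g ⁻¹ ∙ x ∙ (g ∙ (g ⁻¹ ∙ y)) ∙ g    ≈⟨ ∙-congʳ (assoc (g ⁻¹ ∙ x) g (g ⁻¹ ∙ y)) ⟨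
    x ^ᶜ g ∙ (g ⁻¹ ∙ y) ∙ g            ≈⟨ assoc (x ^ᶜ g) (g ⁻¹ ∙ y) g ⟩
    x ^ᶜ g ∙ y ^ᶜ g                    ∎

  ⁻¹-^ᶜ : ∀ x g → x ⁻¹ ^ᶜ g ≈ (x ^ᶜ g) ⁻¹
  ⁻¹-^ᶜ x g = inverseʳ-unique (x ^ᶜ g) (x ⁻¹ ^ᶜ g) (begin
    x ^ᶜ g ∙ x ⁻¹ ^ᶜ g   ≈⟨ ∙-^ᶜ x (x ⁻¹) g ⟨
    (x ∙ x ⁻¹) ^ᶜ g      ≈⟨ ∙-congʳ (∙-congˡ (inverseʳ x)) ⟩
    ε ^ᶜ g               ≈⟨ ε-^ᶜ g ⟩
    ε                    ∎)

  ^ᶜ-^ᶜ : ∀ x g h → x ^ᶜ g ^ᶜ h ≈ x ^ᶜ (g ∙ h)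
  ^ᶜ-^ᶜ x g h = begin
    h ⁻¹ ∙ (g ⁻¹ ∙ x ∙ g) ∙ h       ≈⟨ ∙-congʳ (assoc (h ⁻¹) (g ⁻¹ ∙ x) g) ⟨
    h ⁻¹ ∙ (g ⁻¹ ∙ x) ∙ g ∙ h       ≈⟨ assoc _ g h ⟩
    h ⁻¹ ∙ (g ⁻¹ ∙ x) ∙ (g ∙ h)     ≈⟨ ∙-congʳ (assoc (h ⁻¹) (g ⁻¹) x) ⟨
    h ⁻¹ ∙ g ⁻¹ ∙ x ∙ (g ∙ h)       ≈⟨ ∙-congʳ (∙-congʳ (⁻¹-anti-homo-∙ g h)) ⟨
    (g ∙ h) ⁻¹ ∙ x ∙ (g ∙ h)        ∎

data Kind : Set where
  cyclic dihedral quaternion : Kind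

ReflectionExponent : Kind → ℕ → ℕ → Set
ReflectionExponent cyclic     j i = ⊥
ReflectionExponent dihedral   j i = i ≡ 0 mod2^ j
ReflectionExponent quaternion j i = i ≡ 1 mod2^ j

reflectionExponent? : ∀ κ j i → Dec (ReflectionExponent κ j i)
reflectionExponent? cyclic     j i = no (λ ())
reflectionExponent? dihedral   j i = i ≟ 0 mod2^ j
reflectionExponent? quaternion j i = i ≟ 1 mod2^ j

ReflectionExponent-cong : ∀ κ {j x y} → x ≡ y mod2^ j → ReflectionExponent κ j x → ReflectionExponent κ j y
ReflectionExponent-cong dihedral   x≡y x≡0 = mod-trans (mod-sym x≡y) x≡0
ReflectionExponent-cong quaternion x≡y x≡1 = mod-trans (mod-sym x≡y) x≡1

data _⊑_ : Kind → Kind → Set where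
  cyclic⊑ : ∀ {κ} → cyclic ⊑ κ
  ⊑-refl  : ∀ {κ} → κ ⊑ κ

ReflectionExponent-weaken : ∀ {i j x} κ → i ≤ j → ReflectionExponent κ j x → ReflectionExponent κ i x
ReflectionExponent-weaken dihedral   i≤j x≡0 = mod-weaken i≤j x≡0
ReflectionExponent-weaken quaternion i≤j x≡1 = mod-weaken i≤j x≡1

data Probe : Set where
  a^2^ : ℕ → Probe
  b ab : Probe

MayMeet : Probe → ℕ → Kind → Set
MayMeet (a^2^ l) j κ         = j ≤ l
MayMeet b        j cyclic     = ⊥
MayMeet b        j dihedral   = ⊤
MayMeet b        j quaternion = ⊥
MayMeet ab       j cyclic     = ⊥
MayMeet ab       j dihedral   = j ≡ 0
MayMeet ab       j quaternion = ⊤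

-- Reasons for K → H to preserve trigger d and tests E; in the last one every conjugate of a test
-- lies in K.
data Separation (d : Probe) (E : List Probe) : ℕ × Kind → ℕ × Kind → Set where
  trigger-misses : ∀ {jK κK H} → ¬ MayMeet d jK κK → Separation d E (jK , κK) H
  test-misses    : ∀ {K jH κH} → Any (λ t → ¬ MayMeet t jH κH) E → Separation d E K (jH , κH)
  tests-below    : ∀ {jK κK H} → All (λ t → ∃ λ l → t ≡ a^2^ l × jK ≤ l) E → Separation d E (jK , κK) H

module Semidihedral (k : ℕ) where

  n L : ℕ
  n = 4 + k
  L = 3 + k

  G : Set
  G = SD n

  infixl 7 _·_
  _·_ : G → G → G
  _·_ = mul n

  infix 8 _⁻¹
  _⁻¹ : G → G
  _⁻¹ = inv n

  ε : G
  ε = e n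

  r+1≡2^[L∸1] : r n + 1 ≡ 2 ^ (L ∸ 1)
  r+1≡2^[L∸1] = m∸n+n≡m (m^n>0 2 (2 + k))

  r*r≡1 : r n * r n ≡ 1 mod2^ L
  r*r≡1 = begin
    r n * r n               ≡⟨ +-identityʳ (r n * r n) ⟨
    r n * r n + 0           ≈⟨ mod-+ˡ (r n * r n) (*2^-mod 1) ⟨
    r n * r n + 1 * 2 ^ L   ≡⟨ cong (λ p → r n * r n + 1 * (2 * p)) r+1≡2^[L∸1] ⟨
    r n * r n + 1 * (2 * (r n + 1)) ≡⟨ square-identity (r n) ⟩
    (r n + 1) * (r n + 1) + 1       ≡⟨ cong (λ p → p * p + 1) r+1≡2^[L∸1] ⟩
    P * P + 1               ≡⟨ cong (_+ 1) P*P≡Q*2^L ⟩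
    Q * 2 ^ L + 1           ≈⟨ mod-+ (*2^-mod Q) (mod-refl {x = 1}) ⟩
    1                       ∎
    where
    open ModReasoning L
    P Q : ℕ
    P = 2 ^ (2 + k)
    Q = 2 ^ (1 + k)
    square-identity : ∀ x → x * x + 1 * (2 * (x + 1)) ≡ (x + 1) * (x + 1) + 1
    square-identity = solve-∀
    P*P≡Q*2^L : P * P ≡ Q * 2 ^ L
    P*P≡Q*2^L = trans (*-assoc 2 Q P) (trans (*-comm 2 (Q * P)) (trans (*-assoc Q P 2) (cong (Q *_) (*-comm P 2))))

  r≡1[mod2] : r n ≡ 1 mod2^ 1
  r≡1[mod2] = mod-cancelʳ-+ 1 (begin
    r n + 1      ≡⟨ r+1≡2^[L∸1] ⟩
    2 ^ (2 + k)  ≈⟨ 2^l≡0 {l = 2 + k} (s≤s z≤n) ⟩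
    0            ≈⟨ 2^l≡0 {l = 1} ≤-refl ⟨
    1 + 1        ∎)
    where open ModReasoning 1

  toℕ-red : ∀ x → toℕ (red n x) ≡ x mod2^ L
  toℕ-red x = mod-trans (≡⇒mod (toℕ-fromℕ< _)) (%2^-mod x)

  red-cong : ∀ {x y} → x ≡ y mod2^ L → red n x ≡ red n y
  red-cong p = toℕ-injective (trans (toℕ-fromℕ< _) (trans (%2^-≡ p) (sym (toℕ-fromℕ< _))))

  red-toℕ : ∀ i → red n (toℕ i) ≡ i
  red-toℕ i = toℕ-injective (trans (toℕ-fromℕ< _) (m<n⇒m%n≡m {{N-nonZero n}} (toℕ<n i)))

  complement-+ˡ : ∀ (i : Fin (N n)) → 2 ^ L ∸ toℕ i + toℕ i ≡ 0 mod2^ L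
  complement-+ˡ i = mod-trans (≡⇒mod (m∸n+n≡m (<⇒≤ (toℕ<n i)))) (2^l≡0 ≤-refl)

  complement-+ʳ : ∀ (i : Fin (N n)) → toℕ i + (2 ^ L ∸ toℕ i) ≡ 0 mod2^ L
  complement-+ʳ i = mod-trans (≡⇒mod (+-comm (toℕ i) _)) (complement-+ˡ i)

  twist-cong : ∀ s {x y} → x ≡ y mod2^ L → twist n s x ≡ twist n s y mod2^ L
  twist-cong false p = p
  twist-cong true  p = mod-* p mod-refl

  twist-+ : ∀ s x y → twist n s (x + y) ≡ twist n s x + twist n s y
  twist-+ false x y = refl
  twist-+ true  x y = *-distribʳ-+ (r n) x y

  twist-zero : ∀ s → twist n s 0 ≡ 0
  twist-zero false = refl
  twist-zero true  = refl

  twist-xor : ∀ s t x → twist n (s xor t) x ≡ twist n s (twist n t x) mod2^ L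
  twist-xor false t     x = mod-refl
  twist-xor true  false x = mod-refl
  twist-xor true  true  x = begin
    x                 ≡⟨ *-identityʳ x ⟨
    x * 1             ≈⟨ mod-*ˡ x r*r≡1 ⟨
    x * (r n * r n)   ≡⟨ *-assoc x (r n) (r n) ⟨
    x * r n * r n     ∎
    where open ModReasoning L

  ·-assoc : ∀ x y z → (x · y) · z ≡ x · (y · z)
  ·-assoc (a , s) (a′ , t) (a″ , u) = cong₂ _,_ (red-cong exponent-eq) (xor-assoc s t u)
    where
    open ModReasoning L
    A B C : ℕ
    A = toℕ a
    B = toℕ a′
    C = toℕ a″
    exponent-eq : toℕ (red n (A + twist n s B)) + twist n (s xor t) C
             ≡ A + twist n s (toℕ (red n (B + twist n t C))) mod2^ L
    exponent-eq = begin
      toℕ (red n (A + twist n s B)) + twist n (s xor t) C  ≈⟨ mod-+ (toℕ-red _) (twist-xor s t C) ⟩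
      A + twist n s B + twist n s (twist n t C)            ≡⟨ +-assoc A _ _ ⟩
      A + (twist n s B + twist n s (twist n t C))          ≡⟨ cong (A +_) (twist-+ s B _) ⟨
      A + twist n s (B + twist n t C)                      ≈⟨ mod-+ˡ A (twist-cong s (toℕ-red _)) ⟨
      A + twist n s (toℕ (red n (B + twist n t C)))        ∎

  ·-identityˡ : ∀ x → ε · x ≡ x
  ·-identityˡ (a , s) = cong₂ _,_ (trans (red-cong exponent-eq) (red-toℕ a)) refl
    where
    exponent-eq : toℕ (red n 0) + toℕ a ≡ toℕ a mod2^ L
    exponent-eq = mod-+ (toℕ-red 0) mod-refl

  ·-identityʳ : ∀ x → x · ε ≡ x
  ·-identityʳ (a , s) = cong₂ _,_ (trans (red-cong exponent-eq) (red-toℕ a)) (xor-identityʳ s)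
    where
    open ModReasoning L
    exponent-eq : toℕ a + twist n s (toℕ (red n 0)) ≡ toℕ a mod2^ L
    exponent-eq = begin
      toℕ a + twist n s (toℕ (red n 0))  ≈⟨ mod-+ˡ (toℕ a) (twist-cong s (toℕ-red 0)) ⟩
      toℕ a + twist n s 0                ≡⟨ cong (toℕ a +_) (twist-zero s) ⟩
      toℕ a + 0                          ≡⟨ +-identityʳ (toℕ a) ⟩
      toℕ a                              ∎

  ⁻¹-inverseˡ : ∀ x → x ⁻¹ · x ≡ ε
  ⁻¹-inverseˡ (a , false) = cong₂ _,_ (red-cong (begin
    toℕ (red n (2 ^ L ∸ toℕ a)) + toℕ a   ≈⟨ mod-+ (toℕ-red _) mod-refl ⟩
    2 ^ L ∸ toℕ a + toℕ a                 ≈⟨ complement-+ˡ a ⟩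
    0                                     ∎)) refl
    where open ModReasoning L
  ⁻¹-inverseˡ (a , true) = cong₂ _,_ (red-cong (begin
    toℕ (red n ((2 ^ L ∸ toℕ a) * r n)) + toℕ a * r n   ≈⟨ mod-+ (toℕ-red _) mod-refl ⟩
    (2 ^ L ∸ toℕ a) * r n + toℕ a * r n                 ≡⟨ *-distribʳ-+ (r n) (2 ^ L ∸ toℕ a) (toℕ a) ⟨
    (2 ^ L ∸ toℕ a + toℕ a) * r n                       ≈⟨ mod-* (complement-+ˡ a) mod-refl ⟩
    0                                                   ∎)) refl
    where open ModReasoning L

  ⁻¹-inverseʳ : ∀ x → x · x ⁻¹ ≡ ε
  ⁻¹-inverseʳ (a , false) = cong₂ _,_ (red-cong (begin
    toℕ a + toℕ (red n (2 ^ L ∸ toℕ a))   ≈⟨ mod-+ˡ (toℕ a) (toℕ-red _) ⟩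
    toℕ a + (2 ^ L ∸ toℕ a)               ≈⟨ complement-+ʳ a ⟩
    0                                     ∎)) refl
    where open ModReasoning L
  ⁻¹-inverseʳ (a , true) = cong₂ _,_ (red-cong (begin
    toℕ a + toℕ (red n ((2 ^ L ∸ toℕ a) * r n)) * r n   ≈⟨ mod-+ˡ (toℕ a) (mod-* (toℕ-red _) mod-refl) ⟩
    toℕ a + (2 ^ L ∸ toℕ a) * r n * r n                 ≡⟨ cong (toℕ a +_) (*-assoc (2 ^ L ∸ toℕ a) (r n) (r n)) ⟩
    toℕ a + (2 ^ L ∸ toℕ a) * (r n * r n)               ≈⟨ mod-+ˡ (toℕ a) (mod-*ˡ (2 ^ L ∸ toℕ a) r*r≡1) ⟩
    toℕ a + (2 ^ L ∸ toℕ a) * 1                         ≡⟨ cong (toℕ a +_) (*-identityʳ _) ⟩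
    toℕ a + (2 ^ L ∸ toℕ a)                             ≈⟨ complement-+ʳ a ⟩
    0                                                   ∎)) refl
    where open ModReasoning L

  isGroup : IsGroup _≡_ _·_ ε _⁻¹
  isGroup = record
    { isMonoid = record
      { isSemigroup = record
        { isMagma = record { isEquivalence = isEquivalence ; ∙-cong = cong₂ _·_ }
        ; assoc   = ·-assoc
        }
      ; identity = ·-identityˡ , ·-identityʳ
      }
    ; inverse = ⁻¹-inverseˡ , ⁻¹-inverseʳ
    ; ⁻¹-cong = cong _⁻¹
    }

  group : Group _ _
  group = record { isGroup = isGroup }

  open Conjugation group public using (_^ᶜ_; ε-^ᶜ; ^ᶜ-ε; ∙-^ᶜ; ⁻¹-^ᶜ; ^ᶜ-^ᶜ)
  open import Algebra.Properties.Group group using (⁻¹-anti-homo-∙; //-rightDividesˡ)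

  [x·x]⁻¹·x≡x⁻¹ : ∀ x → (x · x) ⁻¹ · x ≡ x ⁻¹
  [x·x]⁻¹·x≡x⁻¹ x = trans (cong (_· x) (⁻¹-anti-homo-∙ x x)) (//-rightDividesˡ x (x ⁻¹))

  infix 4 _∈ₛ_
  _∈ₛ_ : G → SubSet n → Set
  x ∈ₛ H = InG n x H

  memb-conjG : ∀ g x K → memb n x (conjG n g K) ≡ memb n (x ^ᶜ g) K
  memb-conjG g (i , false) K = lookup∘tabulate _ i
  memb-conjG g (i , true)  K = lookup∘tabulate _ i

  ∈-conjG⁻ : ∀ g x K → x ∈ₛ conjG n g K → x ^ᶜ g ∈ₛ K
  ∈-conjG⁻ g x K p = trans (sym (memb-conjG g x K)) p

  ∈-conjG⁺ : ∀ g x K → x ^ᶜ g ∈ₛ K → x ∈ₛ conjG n g K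
  ∈-conjG⁺ g x K p = trans (memb-conjG g x K) p

  memb-Inter : ∀ x K H → memb n x (Inter n K H) ≡ memb n x K ∧ memb n x H
  memb-Inter (i , false) (A , B) (A′ , B′) = lookup-zipWith _∧_ i A A′
  memb-Inter (i , true)  (A , B) (A′ , B′) = lookup-zipWith _∧_ i B B′

  ∈-Inter⁻ : ∀ x K H → x ∈ₛ Inter n K H → x ∈ₛ K × x ∈ₛ H
  ∈-Inter⁻ x K H p = ∧-true⁻ (trans (sym (memb-Inter x K H)) p)

  ∈-Inter⁺ : ∀ x K H → x ∈ₛ K → x ∈ₛ H → x ∈ₛ Inter n K H
  ∈-Inter⁺ x K H p q = trans (memb-Inter x K H) (∧-true⁺ p q)

  Incl-antisym : ∀ {K H} → Incl n K H → Incl n H K → K ≡ H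
  Incl-antisym {A , B} {A′ , B′} K⊆H H⊆K = cong₂ _,_
    (lookup-ext A A′ (λ i → true⇔true⇒≡ (K⊆H (i , false)) (H⊆K (i , false))))
    (lookup-ext B B′ (λ i → true⇔true⇒≡ (K⊆H (i , true)) (H⊆K (i , true))))

  conjG-isSubgroup : ∀ g {K} → IsSubgroup n K → IsSubgroup n (conjG n g K)
  conjG-isSubgroup g {K} K≤G = record
    { has-e   = ∈-conjG⁺ g ε K (subst (_∈ₛ K) (sym (ε-^ᶜ g)) (has-e K≤G))
    ; has-mul = λ x y x∈ y∈ → ∈-conjG⁺ g (x · y) K (subst (_∈ₛ K) (sym (∙-^ᶜ x y g))
                  (has-mul K≤G (x ^ᶜ g) (y ^ᶜ g) (∈-conjG⁻ g x K x∈) (∈-conjG⁻ g y K y∈)))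
    ; has-inv = λ x x∈ → ∈-conjG⁺ g (x ⁻¹) K (subst (_∈ₛ K) (sym (⁻¹-^ᶜ x g))
                  (has-inv K≤G (x ^ᶜ g) (∈-conjG⁻ g x K x∈)))
    }
    where open IsSubgroup

  Inter-isSubgroup : ∀ {K H} → IsSubgroup n K → IsSubgroup n H → IsSubgroup n (Inter n K H)
  Inter-isSubgroup {K} {H} K≤G H≤G = record
    { has-e   = ∈-Inter⁺ ε K H (has-e K≤G) (has-e H≤G)
    ; has-mul = λ x y x∈ y∈ → ∈-Inter⁺ (x · y) K H
                  (has-mul K≤G x y (proj₁ (∈-Inter⁻ x K H x∈)) (proj₁ (∈-Inter⁻ y K H y∈)))
                  (has-mul H≤G x y (proj₂ (∈-Inter⁻ x K H x∈)) (proj₂ (∈-Inter⁻ y K H y∈)))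
    ; has-inv = λ x x∈ → ∈-Inter⁺ (x ⁻¹) K H
                  (has-inv K≤G x (proj₁ (∈-Inter⁻ x K H x∈))) (has-inv H≤G x (proj₂ (∈-Inter⁻ x K H x∈)))
    }
    where open IsSubgroup

  record TransferClosed (Q : Rel n) : Set₁ where
    field
      closed-refl  : ∀ H → IsSubgroup n H → Q H H
      closed-trans : ∀ {L K H} → Incl n L K → Q L K → Q K H → Q L H
      closed-restr : ∀ {K H L} → Q K H → IsSubgroup n L → Incl n L H → Q (Inter n K L) (Inter n H L)
      closed-conj  : ∀ {K H} → Q K H → ∀ g → Q (conjG n g K) (conjG n g H)

  module Generated (P : Pair n → Set) (P⊆ : ∀ {K H} → P (K , H) → Incl n K H) where

    Gen⇒Incl : ∀ {K H} → Gen n P K H → Incl n K H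
    Gen⇒Incl (base p)                 = P⊆ p
    Gen⇒Incl (Gen.refl H _)     x x∈ = x∈
    Gen⇒Incl (Gen.trans g g′)   x x∈ = Gen⇒Incl g′ x (Gen⇒Incl g x x∈)
    Gen⇒Incl (restr {K} {H} {L} g _ _) x x∈ with ∈-Inter⁻ x K L x∈
    ... | x∈K , x∈L = ∈-Inter⁺ x H L (Gen⇒Incl g x x∈K) x∈L
    Gen⇒Incl (conj {K} {H} g h) x x∈ = ∈-conjG⁺ h x H (Gen⇒Incl g (x ^ᶜ h) (∈-conjG⁻ h x K x∈))

    module _ {Q : Rel n} (Q-closed : TransferClosed Q) (P⇒Q : ∀ {K H} → P (K , H) → Q K H) where
      open TransferClosed Q-closed

      Gen-least : ∀ {K H} → Gen n P K H → Q K H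
      Gen-least (base p)          = P⇒Q p
      Gen-least (Gen.refl H H≤G)  = closed-refl H H≤G
      Gen-least (Gen.trans g g′)  = closed-trans (Gen⇒Incl g) (Gen-least g) (Gen-least g′)
      Gen-least (restr g L≤G L⊆H) = closed-restr (Gen-least g) L≤G L⊆H
      Gen-least (conj g h)        = closed-conj (Gen-least g) h

    module _ (P≤G : ∀ {K H} → P (K , H) → IsSubgroup n K × IsSubgroup n H) where

      Gen-dom : ∀ {K H} → Gen n P K H → IsSubgroup n K × IsSubgroup n H
      Gen-dom (base p)          = P≤G p
      Gen-dom (Gen.refl H H≤G)  = H≤G , H≤G
      Gen-dom (Gen.trans g g′)  = proj₁ (Gen-dom g) , proj₂ (Gen-dom g′)
      Gen-dom (restr g L≤G _)   = Inter-isSubgroup (proj₁ (Gen-dom g)) L≤G , Inter-isSubgroup (proj₂ (Gen-dom g)) L≤G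
      Gen-dom (conj g h)        = conjG-isSubgroup h (proj₁ (Gen-dom g)) , conjG-isSubgroup h (proj₂ (Gen-dom g))

      Gen-isTransferSystem : IsTransferSystem n (Gen n P)
      Gen-isTransferSystem = record
        { dom       = Gen-dom
        ; sub       = Gen⇒Incl
        ; reflT     = Gen.refl
        ; antisym   = λ g g′ → Incl-antisym (Gen⇒Incl g) (Gen⇒Incl g′)
        ; transT    = Gen.trans
        ; restrict  = restr
        ; conjugate = conj
        }

  Preserves : G → List G → Rel n
  Preserves d E K H =
    (∃ λ g → d ^ᶜ g ∈ₛ K) → ∀ h → All (λ t → t ^ᶜ h ∈ₛ H) E → All (λ t → t ^ᶜ h ∈ₛ K) E

  Preserves-transferClosed : ∀ d E → TransferClosed (Preserves d E)
  Preserves-transferClosed d E = record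
    { closed-refl  = λ _ _ _ _ E⊆H → E⊆H
    ; closed-trans = λ L⊆K L→K K→H (g , d∈L) h E⊆H → L→K (g , d∈L) h (K→H (g , L⊆K (d ^ᶜ g) d∈L) h E⊆H)
    ; closed-restr = restr-closed
    ; closed-conj  = conj-closed
    }
    where
    restr-closed : ∀ {K H L} → Preserves d E K H → IsSubgroup n L → Incl n L H →
                   Preserves d E (Inter n K L) (Inter n H L)
    restr-closed {K} {H} {L} K→H _ _ (g , d∈K∩L) h E⊆H∩L =
      All.zipWith (λ {t} (t∈K , t∈L) → ∈-Inter⁺ (t ^ᶜ h) K L t∈K t∈L)
        (K→H (g , proj₁ (∈-Inter⁻ (d ^ᶜ g) K L d∈K∩L)) h (All.map (λ {t} → proj₁ ∘ ∈-Inter⁻ (t ^ᶜ h) H L) E⊆H∩L)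
        , All.map (λ {t} → proj₂ ∘ ∈-Inter⁻ (t ^ᶜ h) H L) E⊆H∩L)
    conj-closed : ∀ {K H} → Preserves d E K H → ∀ c → Preserves d E (conjG n c K) (conjG n c H)
    conj-closed {K} {H} K→H c (g , d∈K^c) h E⊆H^c =
      All.map (λ {t} t∈K → ∈-conjG⁺ c (t ^ᶜ h) K (subst (_∈ₛ K) (sym (^ᶜ-^ᶜ t h c)) t∈K))
        (K→H (g · c , subst (_∈ₛ K) (^ᶜ-^ᶜ d g c) (∈-conjG⁻ c (d ^ᶜ g) K d∈K^c)) (h · c)
          (All.map (λ {t} t∈H → subst (_∈ₛ H) (^ᶜ-^ᶜ t h c) (∈-conjG⁻ c (t ^ᶜ h) H t∈H)) E⊆H^c))

  ¬Preserves : ∀ {d E K H} → d ∈ₛ K → All (_∈ₛ H) E → Any (λ t → ¬ t ∈ₛ K) E → ¬ Preserves d E K H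
  ¬Preserves {d} {E} {K} {H} d∈K E⊆H t∉K K→H =
    Any¬⇒¬All t∉K (All.map (λ {t} → subst (_∈ₛ K) (^ᶜ-ε t))
      (K→H (ε , subst (_∈ₛ K) (sym (^ᶜ-ε d)) d∈K) ε (All.map (λ {t} → subst (_∈ₛ H) (sym (^ᶜ-ε t))) E⊆H)))

  -- U j cyclic, U j dihedral and U j quaternion are C j, D j and Q j.
  U : ℕ → Kind → SubSet n
  U j κ = tabulate (λ i → does (toℕ i ≟ 0 mod2^ j)) , tabulate (λ i → does (reflectionExponent? κ j (toℕ i)))

  -- (ab)² = a^(2^(L−1)) forces j < L for quaternion; as x ≡ 1 mod2^ 0 always holds, U 0 quaternion
  -- would be the whole group.
  Valid : ℕ → Kind → Set
  Valid j cyclic     = j ≤ L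
  Valid j dihedral   = j ≤ L
  Valid j quaternion = 1 ≤ j × j < L

  Valid⇒≤L : ∀ {j} κ → Valid j κ → j ≤ L
  Valid⇒≤L cyclic     j≤L       = j≤L
  Valid⇒≤L dihedral   j≤L       = j≤L
  Valid⇒≤L quaternion (_ , j<L) = <⇒≤ j<L

  rotation∈U⁻ : ∀ {j} κ i → (i , false) ∈ₛ U j κ → toℕ i ≡ 0 mod2^ j
  rotation∈U⁻ {j} κ i p = does-sound (toℕ i ≟ 0 mod2^ j) (trans (sym (lookup∘tabulate _ i)) p)

  rotation∈U⁺ : ∀ {j} κ i → toℕ i ≡ 0 mod2^ j → (i , false) ∈ₛ U j κ
  rotation∈U⁺ {j} κ i p = trans (lookup∘tabulate _ i) (dec-true (toℕ i ≟ 0 mod2^ j) p)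

  reflection∈U⁻ : ∀ {j} κ i → (i , true) ∈ₛ U j κ → ReflectionExponent κ j (toℕ i)
  reflection∈U⁻ {j} κ i p = does-sound (reflectionExponent? κ j (toℕ i)) (trans (sym (lookup∘tabulate _ i)) p)

  reflection∈U⁺ : ∀ {j} κ i → ReflectionExponent κ j (toℕ i) → (i , true) ∈ₛ U j κ
  reflection∈U⁺ {j} κ i p = trans (lookup∘tabulate _ i) (dec-true (reflectionExponent? κ j (toℕ i)) p)

  toℕ-red-mod : ∀ {j} → j ≤ L → ∀ x → toℕ (red n x) ≡ x mod2^ j
  toℕ-red-mod j≤L x = mod-weaken j≤L (toℕ-red x)

  reflection-product : ∀ {j} κ {x y} → Valid j κ →
    ReflectionExponent κ j x → ReflectionExponent κ j y → x + y * r n ≡ 0 mod2^ j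
  reflection-product dihedral _ x≡0 y≡0 = mod-+ x≡0 (mod-* y≡0 mod-refl)
  reflection-product {j} quaternion {x} {y} (_ , j<L) x≡1 y≡1 = begin
    x + y * r n     ≈⟨ mod-+ x≡1 (mod-* y≡1 mod-refl) ⟩
    1 + 1 * r n     ≡⟨ trans (cong (1 +_) (*-identityˡ (r n))) (+-comm 1 (r n)) ⟩
    r n + 1         ≡⟨ r+1≡2^[L∸1] ⟩
    2 ^ (2 + k)     ≈⟨ 2^l≡0 (≤-pred j<L) ⟩
    0               ∎
    where open ModReasoning j

  U-isSubgroup : ∀ {j} κ → Valid j κ → IsSubgroup n (U j κ)
  U-isSubgroup {j} κ valid = record
    { has-e   = rotation∈U⁺ κ (red n 0) (toℕ-red-mod j≤L 0)
    ; has-mul = closed-·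
    ; has-inv = closed-⁻¹
    }
    where
    j≤L : j ≤ L
    j≤L = Valid⇒≤L κ valid
    red-rotation : ∀ {x} → x ≡ 0 mod2^ j → (red n x , false) ∈ₛ U j κ
    red-rotation x≡0 = rotation∈U⁺ κ _ (mod-trans (toℕ-red-mod j≤L _) x≡0)
    red-reflection : ∀ {x y} → ReflectionExponent κ j y → x ≡ y mod2^ j → (red n x , true) ∈ₛ U j κ
    red-reflection y∈ x≡y =
      reflection∈U⁺ κ _ (ReflectionExponent-cong κ (mod-sym (mod-trans (toℕ-red-mod j≤L _) x≡y)) y∈)
    closed-· : ∀ x y → x ∈ₛ U j κ → y ∈ₛ U j κ → x · y ∈ₛ U j κ
    closed-· (a , false) (a′ , false) x∈ y∈ = red-rotation (mod-+ (rotation∈U⁻ κ a x∈) (rotation∈U⁻ κ a′ y∈))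
    closed-· (a , false) (a′ , true)  x∈ y∈ = red-reflection (reflection∈U⁻ κ a′ y∈) (mod-+ (rotation∈U⁻ κ a x∈) mod-refl)
    closed-· (a , true)  (a′ , false) x∈ y∈ = red-reflection (reflection∈U⁻ κ a x∈)
      (mod-trans (mod-+ mod-refl (mod-* (rotation∈U⁻ κ a′ y∈) mod-refl)) (≡⇒mod (+-identityʳ (toℕ a))))
    closed-· (a , true)  (a′ , true)  x∈ y∈ =
      red-rotation (reflection-product κ valid (reflection∈U⁻ κ a x∈) (reflection∈U⁻ κ a′ y∈))
    closed-⁻¹-rotation : ∀ a → (a , false) ∈ₛ U j κ → (a , false) ⁻¹ ∈ₛ U j κ
    closed-⁻¹-rotation a x∈ = red-rotation (mod-cancelʳ-+ (toℕ a)
      (mod-trans (mod-weaken j≤L (complement-+ˡ a)) (mod-sym (rotation∈U⁻ κ a x∈))))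
    -- A reflection x squares to a rotation, and x⁻¹ = (x · x)⁻¹ · x.
    closed-⁻¹ : ∀ x → x ∈ₛ U j κ → x ⁻¹ ∈ₛ U j κ
    closed-⁻¹ (a , false) x∈ = closed-⁻¹-rotation a x∈
    closed-⁻¹ x@(a , true) x∈ = subst (_∈ₛ U j κ) ([x·x]⁻¹·x≡x⁻¹ x)
      (closed-· ((x · x) ⁻¹) x (closed-⁻¹-rotation _ (closed-· x x x∈ x∈)) x∈)

  U-⊆ : ∀ {i j} κ′ κ → i ≤ j → κ′ ⊑ κ → Incl n (U j κ′) (U i κ)
  U-⊆ κ′ κ i≤j _       (c , false) x∈ = rotation∈U⁺ κ c (mod-weaken i≤j (rotation∈U⁻ κ′ c x∈))
  U-⊆ {j = j} _ _ _ cyclic⊑ (c , true)  x∈ = ⊥-elim (reflection∈U⁻ {j} cyclic c x∈)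
  U-⊆ _ κ i≤j ⊑-refl    (c , true)  x∈ =
    reflection∈U⁺ κ c (ReflectionExponent-weaken κ i≤j (reflection∈U⁻ κ c x∈))

  twist≡0⁺ : ∀ {j} s {x} → x ≡ 0 mod2^ j → twist n s x ≡ 0 mod2^ j
  twist≡0⁺ false x≡0 = x≡0
  twist≡0⁺ true  x≡0 = mod-* x≡0 mod-refl

  twist≡0⁻ : ∀ {j} → j ≤ L → ∀ s {x} → twist n s x ≡ 0 mod2^ j → x ≡ 0 mod2^ j
  twist≡0⁻ j≤L false xr≡0 = xr≡0
  twist≡0⁻ {j} j≤L true {x} xr≡0 = begin
    x                  ≡⟨ *-identityʳ x ⟨
    x * 1              ≈⟨ mod-*ˡ x (mod-weaken j≤L r*r≡1) ⟨
    x * (r n * r n)    ≡⟨ *-assoc x (r n) (r n) ⟨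
    x * r n * r n      ≈⟨ mod-* xr≡0 mod-refl ⟩
    0                  ∎
    where open ModReasoning j

  twist≡id[mod2] : ∀ s x → twist n s x ≡ x mod2^ 1
  twist≡id[mod2] false x = mod-refl
  twist≡id[mod2] true  x = mod-trans (mod-*ˡ x r≡1[mod2]) (≡⇒mod (*-identityʳ x))

  rotation-^ᶜ : ∀ i g → (i , false) ^ᶜ g ≡ (red n (twist n (proj₂ g) (toℕ i)) , false)
  rotation-^ᶜ i (h , false) = cong (_, false) (red-cong (begin
    toℕ (red n (toℕ (red n (2 ^ L ∸ H)) + I)) + H   ≈⟨ mod-+ (toℕ-red _) mod-refl ⟩
    toℕ (red n (2 ^ L ∸ H)) + I + H                 ≈⟨ mod-+ (mod-+ (toℕ-red _) mod-refl) mod-refl ⟩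
    2 ^ L ∸ H + I + H                               ≡⟨ cong (_+ H) (+-comm (2 ^ L ∸ H) I) ⟩
    I + (2 ^ L ∸ H) + H                             ≡⟨ +-assoc I _ H ⟩
    I + (2 ^ L ∸ H + H)                             ≈⟨ mod-+ˡ I (complement-+ˡ h) ⟩
    I + 0                                           ≡⟨ +-identityʳ I ⟩
    I                                               ∎))
    where
    open ModReasoning L
    I H : ℕ
    I = toℕ i
    H = toℕ h
  rotation-^ᶜ i (h , true) = cong (_, false) (red-cong (begin
    toℕ (red n (toℕ (red n ((2 ^ L ∸ H) * r n)) + I * r n)) + H * r n   ≈⟨ mod-+ (toℕ-red _) mod-refl ⟩
    toℕ (red n ((2 ^ L ∸ H) * r n)) + I * r n + H * r n                 ≈⟨ mod-+ (mod-+ (toℕ-red _) mod-refl) mod-refl ⟩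
    (2 ^ L ∸ H) * r n + I * r n + H * r n                               ≡⟨ cong (_+ H * r n) (+-comm ((2 ^ L ∸ H) * r n) (I * r n)) ⟩
    I * r n + (2 ^ L ∸ H) * r n + H * r n                               ≡⟨ +-assoc (I * r n) _ _ ⟩
    I * r n + ((2 ^ L ∸ H) * r n + H * r n)                             ≡⟨ cong (I * r n +_) (*-distribʳ-+ (r n) (2 ^ L ∸ H) H) ⟨
    I * r n + (2 ^ L ∸ H + H) * r n                                     ≈⟨ mod-+ˡ (I * r n) (mod-* (complement-+ˡ h) mod-refl) ⟩
    I * r n + 0                                                         ≡⟨ +-identityʳ (I * r n) ⟩
    I * r n                                                             ∎))
    where
    open ModReasoning L
    I H : ℕ
    I = toℕ i
    H = toℕ h

  rotation-^ᶜ∈U⁻ : ∀ {j} κ → j ≤ L → ∀ i g → (i , false) ^ᶜ g ∈ₛ U j κ → toℕ i ≡ 0 mod2^ j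
  rotation-^ᶜ∈U⁻ κ j≤L i g p = twist≡0⁻ j≤L (proj₂ g)
    (mod-trans (mod-sym (toℕ-red-mod j≤L _)) (rotation∈U⁻ κ _ (subst (_∈ₛ U _ κ) (rotation-^ᶜ i g) p)))

  rotation-^ᶜ∈U⁺ : ∀ {j} κ → j ≤ L → ∀ i g → toℕ i ≡ 0 mod2^ j → (i , false) ^ᶜ g ∈ₛ U j κ
  rotation-^ᶜ∈U⁺ κ j≤L i g i≡0 = subst (_∈ₛ U _ κ) (sym (rotation-^ᶜ i g))
    (rotation∈U⁺ κ _ (mod-trans (toℕ-red-mod j≤L _) (twist≡0⁺ (proj₂ g) i≡0)))

  exponent : G → ℕ
  exponent (i , _) = toℕ i

  exponent-· : ∀ x y → exponent (x · y) ≡ exponent x + exponent y mod2^ 1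
  exponent-· (a , s) (c , t) =
    mod-trans (toℕ-red-mod (s≤s z≤n) _) (mod-+ˡ (toℕ a) (twist≡id[mod2] s (toℕ c)))

  -- As r is odd, exponent is a homomorphism to ℤ/2 modulo 2, so it is invariant under conjugation.
  exponent-^ᶜ : ∀ x g → exponent (x ^ᶜ g) ≡ exponent x mod2^ 1
  exponent-^ᶜ x g = begin
    exponent (g ⁻¹ · x · g)                   ≈⟨ mod-trans (exponent-· (g ⁻¹ · x) g) (mod-+ (exponent-· (g ⁻¹) x) mod-refl) ⟩
    exponent (g ⁻¹) + exponent x + exponent g ≡⟨ cong (_+ exponent g) (+-comm (exponent (g ⁻¹)) (exponent x)) ⟩
    exponent x + exponent (g ⁻¹) + exponent g ≡⟨ +-assoc (exponent x) _ _ ⟩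
    exponent x + (exponent (g ⁻¹) + exponent g) ≈⟨ mod-+ˡ (exponent x) (exponent-· (g ⁻¹) g) ⟨
    exponent x + exponent (g ⁻¹ · g)          ≡⟨ cong (λ y → exponent x + exponent y) (⁻¹-inverseˡ g) ⟩
    exponent x + exponent ε                   ≈⟨ mod-+ˡ (exponent x) (toℕ-red-mod (s≤s z≤n) 0) ⟩
    exponent x + 0                            ≡⟨ +-identityʳ (exponent x) ⟩
    exponent x                                ∎
    where open ModReasoning 1

  reflection-^ᶜ : ∀ c g → ∃ λ c′ → (c , true) ^ᶜ g ≡ (c′ , true) × (toℕ c′ ≡ toℕ c mod2^ 1)
  reflection-^ᶜ c g@(_ , false) = _ , refl , exponent-^ᶜ (c , true) g
  reflection-^ᶜ c g@(_ , true)  = _ , refl , exponent-^ᶜ (c , true) g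

  reflection-^ᶜ∈U : ∀ {j} κ c g → (c , true) ^ᶜ g ∈ₛ U j κ →
    ∃ λ c′ → toℕ c′ ≡ toℕ c mod2^ 1 × ReflectionExponent κ j (toℕ c′)
  reflection-^ᶜ∈U κ c g p with reflection-^ᶜ c g
  ... | c′ , conj≡ , c′≡c = c′ , c′≡c , reflection∈U⁻ κ c′ (subst (_∈ₛ U _ κ) conj≡ p)

  element : Probe → G
  element (a^2^ l) = red n (2 ^ l) , false
  element b        = red n 0 , true
  element ab       = red n 1 , true

  conjugate-meets : ∀ t {j} κ → Valid j κ → ∀ g → element t ^ᶜ g ∈ₛ U j κ → MayMeet t j κ
  conjugate-meets (a^2^ l) κ valid g p = 2^l≡0⇒j≤l
    (mod-trans (mod-sym (toℕ-red-mod j≤L (2 ^ l))) (rotation-^ᶜ∈U⁻ κ j≤L _ g p))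
    where j≤L = Valid⇒≤L κ valid
  conjugate-meets b {j} cyclic _ g p = proj₂ (proj₂ (reflection-^ᶜ∈U {j} cyclic _ g p))
  conjugate-meets b dihedral _ _ _ = tt
  conjugate-meets b {j} quaternion (1≤j , _) g p with reflection-^ᶜ∈U {j} quaternion _ g p
  ... | c′ , c′≡0 , c′≡1 = 1≢0[mod2] (begin
    1               ≈⟨ mod-weaken 1≤j c′≡1 ⟨
    toℕ c′          ≈⟨ c′≡0 ⟩
    toℕ (red n 0)   ≈⟨ toℕ-red-mod (s≤s z≤n) 0 ⟩
    0               ∎)
    where open ModReasoning 1
  conjugate-meets ab {j} cyclic _ g p = proj₂ (proj₂ (reflection-^ᶜ∈U {j} cyclic _ g p))
  conjugate-meets ab {zero} dihedral _ _ _ = refl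
  conjugate-meets ab {suc j} dihedral _ g p with reflection-^ᶜ∈U {suc j} dihedral _ g p
  ... | c′ , c′≡1 , c′≡0 = ⊥-elim (1≢0[mod2] (begin
    1               ≈⟨ toℕ-red-mod (s≤s z≤n) 1 ⟨
    toℕ (red n 1)   ≈⟨ c′≡1 ⟨
    toℕ c′          ≈⟨ mod-weaken (s≤s z≤n) c′≡0 ⟩
    0               ∎))
    where open ModReasoning 1
  conjugate-meets ab quaternion _ _ _ = tt

  a^2^-^ᶜ∈U : ∀ {j l} κ → j ≤ L → j ≤ l → ∀ g → element (a^2^ l) ^ᶜ g ∈ₛ U j κ
  a^2^-^ᶜ∈U κ j≤L j≤l g = rotation-^ᶜ∈U⁺ κ j≤L _ g (mod-trans (toℕ-red-mod j≤L _) (2^l≡0 j≤l))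

  a^2^∈U : ∀ {j} κ l → j ≤ L → j ≤ l → element (a^2^ l) ∈ₛ U j κ
  a^2^∈U {j} κ l j≤L j≤l = subst (_∈ₛ U j κ) (^ᶜ-ε (element (a^2^ l))) (a^2^-^ᶜ∈U κ j≤L j≤l ε)

  b∈U : ∀ {j} → j ≤ L → element b ∈ₛ U j dihedral
  b∈U j≤L = reflection∈U⁺ dihedral (red n 0) (toℕ-red-mod j≤L 0)

  ab∈U : ∀ {j} → Valid j quaternion → element ab ∈ₛ U j quaternion
  ab∈U valid = reflection∈U⁺ quaternion (red n 1) (toℕ-red-mod (Valid⇒≤L quaternion valid) 1)

  element∉U : ∀ t {j} κ → Valid j κ → ¬ MayMeet t j κ → ¬ element t ∈ₛ U j κ
  element∉U t {j} κ valid ¬meet p =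
    ¬meet (conjugate-meets t κ valid ε (subst (_∈ₛ U j κ) (sym (^ᶜ-ε (element t))) p))

  ⟦_⟧ : ℕ × Kind → SubSet n
  ⟦ j , κ ⟧ = U j κ

  ⟦⟧-isSubgroup : ∀ s → uncurry Valid s → IsSubgroup n ⟦ s ⟧
  ⟦⟧-isSubgroup (j , κ) = U-isSubgroup κ

  separation⇒preserves : ∀ {d E jK κK jH κH} → Valid jK κK → Valid jH κH →
    Separation d E (jK , κK) (jH , κH) → Preserves (element d) (map element E) (U jK κK) (U jH κH)
  separation⇒preserves {d} {κK = κK} validK _ (trigger-misses ¬meet) (g , d∈K) =
    ⊥-elim (¬meet (conjugate-meets d κK validK g d∈K))
  separation⇒preserves {κH = κH} _ validH (test-misses t-misses) _ h E⊆H =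
    ⊥-elim (Any¬⇒¬All t-misses (All.map (λ {t} → conjugate-meets t κH validH h) (map⁻ E⊆H)))
  separation⇒preserves {κK = κK} validK _ (tests-below below) _ h _ =
    map⁺ (All.map (λ { (l , refl , jK≤l) → a^2^-^ᶜ∈U κK (Valid⇒≤L κK validK) jK≤l h }) below)

data Generator : Set where
  CD CQ CC DD QQ : ℕ → Generator
  top : Generator

module Generators (a δ : ℕ) (δ≤1 : δ ≤ 1) where
  open Semidihedral (a + a + δ)

  m : ℕ
  m = 2 + a

  source target : Generator → ℕ × Kind
  source (CD i) = m + i , cyclic
  source (CQ i) = m + i , cyclic
  source (CC i) = m + i , cyclic
  source (DD t) = suc (m + t) , dihedral
  source (QQ t) = suc (m + t) , quaternion
  source top    = L , cyclic
  target (CD i) = m ∸ i , dihedral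
  target (CQ i) = m ∸ i , quaternion
  target (CC i) = m ∸ suc i , cyclic
  target (DD t) = m + t , dihedral
  target (QQ t) = m + t , quaternion
  target top    = 0 , dihedral

  trigger : Generator → Probe
  trigger (CD i) = a^2^ (m + i)
  trigger (CQ i) = a^2^ (m + i)
  trigger (CC i) = a^2^ (m + i)
  trigger (DD t) = b
  trigger (QQ t) = ab
  trigger top    = a^2^ L

  tests : Generator → List Probe
  tests (CD i) = b ∷ a^2^ (m ∸ i) ∷ []
  tests (CQ i) = ab ∷ a^2^ (m ∸ i) ∷ []
  tests (CC i) = a^2^ (m ∸ suc i) ∷ []
  tests (DD t) = a^2^ (m + t) ∷ []
  tests (QQ t) = a^2^ (m + t) ∷ []
  tests top    = a^2^ 0 ∷ b ∷ []

  InRange : Generator → Set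
  InRange (CD i) = i < m
  InRange (CQ i) = i < m
  InRange (CC i) = i < m
  InRange (DD t) = suc (m + t) ≤ L
  InRange (QQ t) = suc (suc (m + t)) ≤ L
  InRange top    = 1 ≤ δ

  pair : Generator → Pair n
  pair x = ⟦ source x ⟧ , ⟦ target x ⟧

  Respects : Generator → Rel n
  Respects x = Preserves (element (trigger x)) (map element (tests x))

  L≡m+[1+a+δ] : L ≡ m + suc (a + δ)
  L≡m+[1+a+δ] = lemma a δ
    where
    lemma : ∀ a δ → 3 + (a + a + δ) ≡ 2 + a + suc (a + δ)
    lemma = solve-∀

  <m+[1+a+δ]⇒<L : ∀ {x} → x < m + suc (a + δ) → x < L
  <m+[1+a+δ]⇒<L lt = ≤-trans lt (≤-reflexive (sym L≡m+[1+a+δ]))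

  m<L : m < L
  m<L = <m+[1+a+δ]⇒<L (m<m+n m z<s)

  m+i≤L : ∀ {i} → i < m → m + i ≤ L
  m+i≤L {i} (s≤s i≤1+a) = subst (m + i ≤_) (sym L≡m+[1+a+δ]) (+-monoʳ-≤ m (≤-trans i≤1+a (s≤s (m≤m+n a δ))))

  m+i<L : ∀ {i} → 1 ≤ δ → i < m → m + i < L
  m+i<L 1≤δ (s≤s i≤1+a) =
    <m+[1+a+δ]⇒<L (+-monoʳ-< m (s≤s (≤-trans i≤1+a (≤-trans (≤-reflexive (+-comm 1 a)) (+-monoʳ-≤ a 1≤δ)))))

  0<m∸i : ∀ {i} → i < m → 0 < m ∸ i
  0<m∸i = m<n⇒0<n∸m

  m∸[1+i]<m : ∀ {i} → i < m → m ∸ suc i < m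
  m∸[1+i]<m i<m = ∸-monoʳ-< z<s i<m

  valid-source : ∀ x → InRange x → uncurry Valid (source x)
  valid-source (CD i) i<m = m+i≤L i<m
  valid-source (CQ i) i<m = m+i≤L i<m
  valid-source (CC i) i<m = m+i≤L i<m
  valid-source (DD t) in-range = in-range
  valid-source (QQ t) in-range = s≤s z≤n , in-range
  valid-source top    _ = ≤-refl

  valid-target : ∀ x → InRange x → uncurry Valid (target x)
  valid-target (CD i) _   = ≤-trans (m∸n≤m m i) (<⇒≤ m<L)
  valid-target (CQ i) i<m = 0<m∸i i<m , ≤-<-trans (m∸n≤m m i) m<L
  valid-target (CC i) _   = ≤-trans (m∸n≤m m (suc i)) (<⇒≤ m<L)
  valid-target (DD t) in-range = <⇒≤ in-range
  valid-target (QQ t) in-range = s≤s z≤n , ≤-trans (n≤1+n _) in-range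
  valid-target top    _ = z≤n

  source⊆target : ∀ x → Incl n ⟦ source x ⟧ ⟦ target x ⟧
  source⊆target (CD i) = U-⊆ cyclic dihedral (≤-trans (m∸n≤m m i) (m≤m+n m i)) cyclic⊑
  source⊆target (CQ i) = U-⊆ cyclic quaternion (≤-trans (m∸n≤m m i) (m≤m+n m i)) cyclic⊑
  source⊆target (CC i) = U-⊆ cyclic cyclic (≤-trans (m∸n≤m m (suc i)) (m≤m+n m i)) cyclic⊑
  source⊆target (DD t) = U-⊆ dihedral dihedral (n≤1+n (m + t)) ⊑-refl
  source⊆target (QQ t) = U-⊆ quaternion quaternion (n≤1+n (m + t)) ⊑-refl
  source⊆target top    = U-⊆ cyclic dihedral (z≤n {L}) cyclic⊑

  ¬Respects-self : ∀ x → InRange x → ¬ Respects x ⟦ source x ⟧ ⟦ target x ⟧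
  ¬Respects-self x@(CD i) i<m = ¬Preserves
    (a^2^∈U cyclic (m + i) (m+i≤L i<m) ≤-refl)
    (b∈U (valid-target x i<m) ∷ a^2^∈U dihedral (m ∸ i) (valid-target x i<m) ≤-refl ∷ [])
    (here (element∉U b cyclic (m+i≤L i<m) (λ ())))
  ¬Respects-self x@(CQ i) i<m = ¬Preserves
    (a^2^∈U cyclic (m + i) (m+i≤L i<m) ≤-refl)
    (ab∈U (valid-target x i<m) ∷ a^2^∈U quaternion (m ∸ i) (Valid⇒≤L quaternion (valid-target x i<m)) ≤-refl ∷ [])
    (here (element∉U ab cyclic (m+i≤L i<m) (λ ())))
  ¬Respects-self x@(CC i) i<m = ¬Preserves
    (a^2^∈U cyclic (m + i) (m+i≤L i<m) ≤-refl)
    (a^2^∈U cyclic (m ∸ suc i) (valid-target x i<m) ≤-refl ∷ [])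
    (here (element∉U (a^2^ (m ∸ suc i)) cyclic (m+i≤L i<m) (<⇒≱ (<-≤-trans (m∸[1+i]<m i<m) (m≤m+n m i)))))
  ¬Respects-self x@(DD t) in-range = ¬Preserves
    (b∈U in-range)
    (a^2^∈U dihedral (m + t) (valid-target x in-range) ≤-refl ∷ [])
    (here (element∉U (a^2^ (m + t)) dihedral in-range (<-irrefl refl)))
  ¬Respects-self x@(QQ t) in-range = ¬Preserves
    (ab∈U (valid-source x in-range))
    (a^2^∈U quaternion (m + t) (Valid⇒≤L quaternion (valid-target x in-range)) ≤-refl ∷ [])
    (here (element∉U (a^2^ (m + t)) quaternion (valid-source x in-range) (<-irrefl refl)))
  ¬Respects-self top _ = ¬Preserves
    (a^2^∈U cyclic L ≤-refl ≤-refl)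
    (a^2^∈U dihedral 0 z≤n z≤n ∷ b∈U z≤n ∷ [])
    (here (element∉U (a^2^ 0) cyclic ≤-refl (λ ())))


  m+i′≰m+i : ∀ {i i′} → i < i′ → ¬ m + i′ ≤ m + i
  m+i′≰m+i i<i′ = <⇒≱ (+-monoʳ-< m i<i′)

  m+t≰m∸[1+i] : ∀ {i} t → i < m → ¬ m + t ≤ m ∸ suc i
  m+t≰m∸[1+i] t i<m = <⇒≱ (<-≤-trans (m∸[1+i]<m i<m) (m≤m+n m t))

  separate-rotations : ∀ {r κ i i′} → i < m → i ≢ i′ →
    Separation (a^2^ (m + i)) (r ∷ a^2^ (m ∸ i) ∷ []) (m + i′ , cyclic) (m ∸ i′ , κ)
  separate-rotations {i = i} {i′} i<m i≢i′ with <-cmp i i′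
  ... | tri< i<i′ _ _ = trigger-misses (m+i′≰m+i i<i′)
  ... | tri≈ _ i≡i′ _ = ⊥-elim (i≢i′ i≡i′)
  ... | tri> _ _ i′<i = test-misses (there (here (<⇒≱ (∸-monoʳ-< i′<i (<⇒≤ i<m)))))

  separate-from-chain : ∀ {r κ} i t → i < m →
    Separation (a^2^ (m + i)) (r ∷ a^2^ (m ∸ i) ∷ []) (suc (m + t) , κ) (m + t , κ)
  separate-from-chain zero    t _   = trigger-misses (<⇒≱ (s≤s (≤-trans (≤-reflexive (+-identityʳ m)) (m≤m+n m t))))
  separate-from-chain (suc i) t i<m = test-misses (there (here (m+t≰m∸[1+i] t (<⇒≤ i<m))))

  separate-chain : ∀ {d κ t t′} → t ≢ t′ → Separation d (a^2^ (m + t) ∷ []) (suc (m + t′) , κ) (m + t′ , κ)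
  separate-chain {t = t} {t′} t≢t′ with <-cmp t t′
  ... | tri< t<t′ _ _ = test-misses (here (m+i′≰m+i t<t′))
  ... | tri≈ _ t≡t′ _ = ⊥-elim (t≢t′ t≡t′)
  ... | tri> _ _ t′<t = tests-below ((m + t , refl , +-monoʳ-< m t′<t) ∷ [])

  separate-CC : ∀ {κ i i′} → i < m →
    Separation (a^2^ (m + i)) (a^2^ (m ∸ suc i) ∷ []) (m + i′ , cyclic) (m ∸ i′ , κ)
  separate-CC {i = i} {i′} i<m with i <? i′
  ... | yes i<i′ = trigger-misses (m+i′≰m+i i<i′)
  ... | no  i≮i′ = test-misses (here (<⇒≱ (∸-monoʳ-< (s≤s (≮⇒≥ i≮i′)) i<m)))

  separate : ∀ x y → InRange x → InRange y → x ≢ y → Separation (trigger x) (tests x) (source y) (target y)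
  separate (CD i) (CD i′) i<m _ x≢y = separate-rotations i<m (λ { refl → x≢y refl })
  separate (CD i) (CQ _)  _ _ _ = test-misses (here (λ ()))
  separate (CD i) (CC _)  _ _ _ = test-misses (here (λ ()))
  separate (CD i) (DD t)  i<m _ _ = separate-from-chain i t i<m
  separate (CD i) (QQ _)  _ _ _ = test-misses (here (λ ()))
  separate (CD i) top     i<m 1≤δ _ = trigger-misses (<⇒≱ (m+i<L 1≤δ i<m))
  separate (CQ i) (CD i′) _ i′<m _ = test-misses (here (λ m∸i′≡0 → <⇒≢ (0<m∸i i′<m) (sym m∸i′≡0)))
  separate (CQ i) (CQ i′) i<m _ x≢y = separate-rotations i<m (λ { refl → x≢y refl })
  separate (CQ i) (CC _)  _ _ _ = test-misses (here (λ ()))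
  separate (CQ i) (DD _)  _ _ _ = test-misses (here (λ ()))
  separate (CQ i) (QQ t)  i<m _ _ = separate-from-chain i t i<m
  separate (CQ i) top     i<m 1≤δ _ = trigger-misses (<⇒≱ (m+i<L 1≤δ i<m))
  separate (CC i) (CD _)  i<m _ _ = separate-CC i<m
  separate (CC i) (CQ _)  i<m _ _ = separate-CC i<m
  separate (CC i) (CC i′) i<m _ x≢y with <-cmp i i′
  ... | tri< i<i′ _ _ = trigger-misses (m+i′≰m+i i<i′)
  ... | tri≈ _ refl _ = ⊥-elim (x≢y refl)
  ... | tri> _ _ i′<i = test-misses (here (<⇒≱ (∸-monoʳ-< (s≤s i′<i) i<m)))
  separate (CC i) (DD t)  i<m _ _ = test-misses (here (m+t≰m∸[1+i] t i<m))
  separate (CC i) (QQ t)  i<m _ _ = test-misses (here (m+t≰m∸[1+i] t i<m))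
  separate (CC i) top     i<m 1≤δ _ = trigger-misses (<⇒≱ (m+i<L 1≤δ i<m))
  separate (DD t) (CD _)  _ _ _ = trigger-misses (λ ())
  separate (DD t) (CQ _)  _ _ _ = trigger-misses (λ ())
  separate (DD t) (CC _)  _ _ _ = trigger-misses (λ ())
  separate (DD t) (DD t′) _ _ x≢y = separate-chain (λ { refl → x≢y refl })
  separate (DD t) (QQ _)  _ _ _ = trigger-misses (λ ())
  separate (DD t) top     _ _ _ = trigger-misses (λ ())
  separate (QQ t) (CD _)  _ _ _ = trigger-misses (λ ())
  separate (QQ t) (CQ _)  _ _ _ = trigger-misses (λ ())
  separate (QQ t) (CC _)  _ _ _ = trigger-misses (λ ())
  separate (QQ t) (DD _)  _ _ _ = trigger-misses (λ ())
  separate (QQ t) (QQ t′) _ _ x≢y = separate-chain (λ { refl → x≢y refl })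
  separate (QQ t) top     _ _ _ = trigger-misses (λ ())
  separate top    (CD i)  _ i<m _ = test-misses (here (<⇒≱ (0<m∸i i<m)))
  separate top    (CQ i)  _ i<m _ = test-misses (here (<⇒≱ (0<m∸i i<m)))
  separate top    (CC _)  _ _ _ = test-misses (there (here (λ ())))
  separate top    (DD _)  _ _ _ = test-misses (here (λ ()))
  separate top    (QQ _)  _ _ _ = test-misses (here (λ ()))
  separate top    top     _ _ x≢y = ⊥-elim (x≢y refl)

  Respects-other : ∀ x y → InRange x → InRange y → x ≢ y → Respects x ⟦ source y ⟧ ⟦ target y ⟧
  Respects-other x y x-in y-in x≢y =
    separation⇒preserves (valid-source y y-in) (valid-target y y-in) (separate x y x-in y-in x≢y)

  pair-≢ : ∀ {x y} → InRange x → InRange y → x ≢ y → pair x ≢ pair y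
  pair-≢ {x} {y} x-in y-in x≢y pair≡ =
    ¬Respects-self x x-in (subst (uncurry (Respects x)) (sym pair≡) (Respects-other x y x-in y-in x≢y))

  tops : ℕ → List Generator
  tops zero    = []
  tops (suc _) = top ∷ []

  generators : List Generator
  generators = tops δ ++ applyUpTo CD m ++ applyUpTo CQ m ++ applyUpTo CC m
             ++ applyUpTo DD (suc (a + δ)) ++ applyUpTo QQ (a + δ)

  generators-inRange : All InRange generators
  generators-inRange =
    ++⁺ (tops-inRange δ ≤-refl) (++⁺ (applyUpTo⁺₁ CD m id) (++⁺ (applyUpTo⁺₁ CQ m id) (++⁺ (applyUpTo⁺₁ CC m id)
      (++⁺ (applyUpTo⁺₁ DD (suc (a + δ)) DD-inRange) (applyUpTo⁺₁ QQ (a + δ) QQ-inRange)))))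
    where
    tops-inRange : ∀ d → d ≤ δ → All InRange (tops d)
    tops-inRange zero    _     = []
    tops-inRange (suc _) 1+d≤δ = ≤-trans (s≤s z≤n) 1+d≤δ ∷ []
    DD-inRange : ∀ {t} → t < suc (a + δ) → InRange (DD t)
    DD-inRange {t} t< =
      subst (suc (m + t) ≤_) (sym L≡m+[1+a+δ]) (subst (_≤ m + suc (a + δ)) (+-suc m t) (+-monoʳ-≤ m t<))
    QQ-inRange : ∀ {t} → t < a + δ → InRange (QQ t)
    QQ-inRange {t} t< = subst (λ x → suc x ≤ L) (+-suc m t) (DD-inRange (s≤s t<))

  count : ℕ
  count = δ + (m + (m + (m + (suc (a + δ) + (a + δ)))))

  -- key numbers the generators consecutively, which gives both their distinctness and their number.
  key : Generator → ℕ
  key top    = 0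
  key (CD i) = δ + i
  key (CQ i) = δ + (m + i)
  key (CC i) = δ + (m + (m + i))
  key (DD t) = δ + (m + (m + (m + t)))
  key (QQ t) = δ + (m + (m + (m + (suc (a + δ) + t))))

  keys-generators : map key generators ≡ upTo count
  keys-generators =
    map-++≡applyUpTo-+ key id δ (tops δ) _ (keys-tops δ δ≤1)
      (map-++≡applyUpTo-+ key (δ +_) m (applyUpTo CD m) _ (map-applyUpTo CD key m)
        (map-++≡applyUpTo-+ key (λ i → δ + (m + i)) m (applyUpTo CQ m) _ (map-applyUpTo CQ key m)
          (map-++≡applyUpTo-+ key (λ i → δ + (m + (m + i))) m (applyUpTo CC m) _ (map-applyUpTo CC key m)
            (map-++≡applyUpTo-+ key (λ t → δ + (m + (m + (m + t)))) (suc (a + δ)) (applyUpTo DD (suc (a + δ))) _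
              (map-applyUpTo DD key (suc (a + δ)))
              (map-applyUpTo QQ key (a + δ))))))
    where
    keys-tops : ∀ d → d ≤ 1 → map key (tops d) ≡ upTo d
    keys-tops zero       _ = refl
    keys-tops (suc zero) _ = refl
    keys-tops (suc (suc _)) (s≤s ())

  generators-unique : Unique generators
  generators-unique = Unique.map⁻ (subst Unique (sym keys-generators) (Unique.upTo⁺ count))

  length-generators : length generators ≡ count
  length-generators = trans (sym (length-map key generators)) (trans (cong length keys-generators) (length-upTo count))

  ⌊5L/2⌋≡count : ⌊ 5 * L /2⌋ ≡ count
  ⌊5L/2⌋≡count = split δ δ≤1
    where
    split : ∀ d → d ≤ 1 → ⌊ 5 * (3 + (a + a + d)) /2⌋ ≡ d + (m + (m + (m + (suc (a + d) + (a + d)))))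
    split zero _ = begin
      ⌊ 5 * (3 + (a + a + 0)) /2⌋      ≡⟨ cong ⌊_/2⌋ (even a) ⟩
      ⌊ c + c + 1 /2⌋                   ≡⟨ ⌊x+x+y/2⌋≡x+⌊y/2⌋ c 1 ⟩
      c + 0                             ≡⟨ count-even a ⟩
      0 + (m + (m + (m + (suc (a + 0) + (a + 0))))) ∎
      where
      open ≡-Reasoning
      c = 5 * a + 7
      even : ∀ a → 5 * (3 + (a + a + 0)) ≡ (5 * a + 7) + (5 * a + 7) + 1
      even = solve-∀
      count-even : ∀ a → 5 * a + 7 + 0 ≡ 0 + (2 + a + (2 + a + (2 + a + (suc (a + 0) + (a + 0)))))
      count-even = solve-∀
    split (suc zero) _ = begin
      ⌊ 5 * (3 + (a + a + 1)) /2⌋      ≡⟨ cong ⌊_/2⌋ (odd a) ⟩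
      ⌊ c + c + 0 /2⌋                   ≡⟨ ⌊x+x+y/2⌋≡x+⌊y/2⌋ c 0 ⟩
      c + 0                             ≡⟨ count-odd a ⟩
      1 + (m + (m + (m + (suc (a + 1) + (a + 1))))) ∎
      where
      open ≡-Reasoning
      c = 5 * a + 10
      odd : ∀ a → 5 * (3 + (a + a + 1)) ≡ (5 * a + 10) + (5 * a + 10) + 0
      odd = solve-∀
      count-odd : ∀ a → 5 * a + 10 + 0 ≡ 1 + (2 + a + (2 + a + (2 + a + (suc (a + 1) + (a + 1)))))
      count-odd = solve-∀
    split (suc (suc _)) (s≤s ())

  S : List (Pair n)
  S = map pair generators

  S-unique : Unique S
  S-unique = Unique-map⁺ pair-≢ generators-inRange generators-unique

  S-⊆ : ∀ {K H} → (K , H) ∈ S → Incl n K H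
  S-⊆ K→H∈S with ∈-map⁻ pair K→H∈S
  ... | x , _ , refl = source⊆target x

  S-subgroups : ∀ {K H} → (K , H) ∈ S → IsSubgroup n K × IsSubgroup n H
  S-subgroups K→H∈S with ∈-map⁻ pair K→H∈S
  ... | x , x∈ , refl = ⟦⟧-isSubgroup (source x) (valid-source x x-in) , ⟦⟧-isSubgroup (target x) (valid-target x x-in)
    where x-in = All.lookup generators-inRange x∈

  S-minimal : ∀ {z} → z ∈ S → ¬ Gen n (λ w → w ∈ S × w ≢ z) (proj₁ z) (proj₂ z)
  S-minimal z∈S with ∈-map⁻ pair z∈S
  ... | x , x∈ , refl = ¬Respects-self x (inRange x∈) ∘ Gen-least (Preserves-transferClosed _ _) others-respect
    where
    inRange : ∀ {y} → y ∈ generators → InRange y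
    inRange = All.lookup generators-inRange
    Others : Pair n → Set
    Others w = w ∈ S × w ≢ pair x
    Others⊆ : ∀ {K H} → Others (K , H) → Incl n K H
    Others⊆ (w∈S , _) = S-⊆ w∈S
    open Generated Others Others⊆
    others-respect : ∀ {K H} → Others (K , H) → Respects x K H
    others-respect (w∈S , w≢) with ∈-map⁻ pair w∈S
    ... | y , y∈ , refl = Respects-other x y (inRange x∈) (inRange y∈) (λ x≡y → w≢ (cong pair (sym x≡y)))

  large-minimal-basis : Σ (Rel n) λ T → IsTransferSystem n T ×
    Σ (List (Pair n)) λ S → Unique S × IsMinGenSet n T S × ⌊ 5 * (n ∸ 1) /2⌋ ≤ length S
  large-minimal-basis =
    Gen n (_∈ S) , Generated.Gen-isTransferSystem (_∈ S) S-⊆ S-subgroups ,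
    S , S-unique ,
    record { generates = λ _ _ → id , id ; minimal = S-minimal } ,
    ≤-reflexive (trans ⌊5L/2⌋≡count (sym (trans (length-map pair generators) length-generators)))

parity-split : ∀ k → ∃ λ a → ∃ λ δ → δ ≤ 1 × a + a + δ ≡ k
parity-split zero          = 0 , 0 , z≤n , refl
parity-split (suc zero)    = 0 , 1 , s≤s z≤n , refl
parity-split (suc (suc k)) with parity-split k
... | a , δ , δ≤1 , refl = suc a , δ , δ≤1 , cong (λ x → suc x + δ) (+-suc a a)

theoremE : (n : ℕ) → 4 ≤ n →
    Σ (Rel n) λ T → IsTransferSystem n T ×
      Σ (List (Pair n)) λ S → Unique S × IsMinGenSet n T S ×
        ⌊ 5 * (n ∸ 1) /2⌋ ≤ length S
theoremE (suc (suc (suc (suc k)))) (s≤s (s≤s (s≤s (s≤s z≤n)))) with parity-split k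
... | a , δ , δ≤1 , refl = Generators.large-minimal-basis a δ δ≤1
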